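{- Let $\mathcal{K}$ be a 2-category and $\mathcal{H}$ a class of corepresentably surjective 1-cells in $\mathcal{K}$. Then $\mathsf{LInj}(\mathcal{H})$ and $\mathsf{RInj}(\mathcal{H})$ are full sub-2-categories of $\mathcal{K}$; i.e. every 1-cell between objects of $\mathsf{RInj}(\mathcal{H})$ preserves the right Kan extensions along maps in $\mathcal{H}$, and similarly for left.
   Context: A 1-cell $f:A\to B$ is corepresentably surjective if for every object $X$ the functor $-\circ f:\mathcal{K}(B,X)\to\mathcal{K}(A,X)$ is conservative. A right Kan extension of $x:A\to X$ along $f$ is a universal pair $(\mathrm{ran}_fx,\epsilon:\mathrm{ran}_fx\circ f\Rightarrow x)$; left Kan extension dually $(\mathrm{lan}_fx,\eta:x\Rightarrow\mathrm{lan}_fx\circ f)$. A 1-cell $g$ preserves it if whiskering by $g$ yields again such an extension. $X$ is right (resp. left) Kan injective w.r.t. $f$ if all right (resp. left) Kan extensions of 1-cells $A\to X$ along $f$ exist with invertible counit (resp. unit). $\mathsf{RInj}(\mathcal{H})$ (resp. $\mathsf{LInj}(\mathcal{H})$) is the locally full sub-2-category whose objects are right (resp. left) Kan injective w.r.t. all maps in $\mathcal{H}$ and whose 1-cells preserve these right (resp. left) Kan extensions. -}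

module Defs where

open import Level using (Level; _⊔_) renaming (suc to lsuc)
open import Data.Product using (Σ; _×_; _,_)
open import Relation.Binary.PropositionalEquality using (_≡_; sym; subst₂)

-- A (strict) 2-category.  1-cell equations hold up to _≡_; 2-cells between
-- propositionally equal 1-cells are compared after transport (subst₂).
record TwoCategory (o ℓ e : Level) : Set (lsuc (o ⊔ ℓ ⊔ e)) where
  infixr 9 _∘₁_
  infixr 9 _∘ᵥ_
  infixr 10 _∘ₕ_
  field
    Obj   : Set o
    _⇒₁_  : Obj → Obj → Set ℓ
    _⇒₂_  : {A B : Obj} → A ⇒₁ B → A ⇒₁ B → Set e

    id₁   : {A : Obj} → A ⇒₁ A
    _∘₁_  : {A B C : Obj} → B ⇒₁ C → A ⇒₁ B → A ⇒₁ C
    identityˡ₁ : {A B : Obj} {f : A ⇒₁ B} → id₁ ∘₁ f ≡ f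
    identityʳ₁ : {A B : Obj} {f : A ⇒₁ B} → f ∘₁ id₁ ≡ f
    assoc₁ : {A B C D : Obj} {f : A ⇒₁ B} {g : B ⇒₁ C} {h : C ⇒₁ D}
           → (h ∘₁ g) ∘₁ f ≡ h ∘₁ (g ∘₁ f)

    id₂   : {A B : Obj} {f : A ⇒₁ B} → f ⇒₂ f
    _∘ᵥ_  : {A B : Obj} {f g h : A ⇒₁ B} → g ⇒₂ h → f ⇒₂ g → f ⇒₂ h
    identityˡᵥ : {A B : Obj} {f g : A ⇒₁ B} {α : f ⇒₂ g} → id₂ ∘ᵥ α ≡ α
    identityʳᵥ : {A B : Obj} {f g : A ⇒₁ B} {α : f ⇒₂ g} → α ∘ᵥ id₂ ≡ α
    assocᵥ : {A B : Obj} {f g h k : A ⇒₁ B}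
             {α : f ⇒₂ g} {β : g ⇒₂ h} {γ : h ⇒₂ k}
           → (γ ∘ᵥ β) ∘ᵥ α ≡ γ ∘ᵥ (β ∘ᵥ α)

    _∘ₕ_  : {A B C : Obj} {f f' : A ⇒₁ B} {g g' : B ⇒₁ C}
          → g ⇒₂ g' → f ⇒₂ f' → (g ∘₁ f) ⇒₂ (g' ∘₁ f')
    ∘ₕ-id : {A B C : Obj} {f : A ⇒₁ B} {g : B ⇒₁ C}
          → id₂ {f = g} ∘ₕ id₂ {f = f} ≡ id₂
    interchange : {A B C : Obj} {f f' f'' : A ⇒₁ B} {g g' g'' : B ⇒₁ C}
                  {α : f ⇒₂ f'} {α' : f' ⇒₂ f''} {β : g ⇒₂ g'} {β' : g' ⇒₂ g''}
                → (β' ∘ᵥ β) ∘ₕ (α' ∘ᵥ α) ≡ (β' ∘ₕ α') ∘ᵥ (β ∘ₕ α)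
    identityˡₕ : {A B : Obj} {f f' : A ⇒₁ B} {α : f ⇒₂ f'}
               → id₂ {f = id₁} ∘ₕ α ≡ subst₂ _⇒₂_ (sym identityˡ₁) (sym identityˡ₁) α
    identityʳₕ : {A B : Obj} {f f' : A ⇒₁ B} {α : f ⇒₂ f'}
               → α ∘ₕ id₂ {f = id₁} ≡ subst₂ _⇒₂_ (sym identityʳ₁) (sym identityʳ₁) α
    assocₕ : {A B C D : Obj} {f f' : A ⇒₁ B} {g g' : B ⇒₁ C} {h h' : C ⇒₁ D}
             {α : f ⇒₂ f'} {β : g ⇒₂ g'} {γ : h ⇒₂ h'}
           → (γ ∘ₕ β) ∘ₕ α ≡ subst₂ _⇒₂_ (sym assoc₁) (sym assoc₁) (γ ∘ₕ (β ∘ₕ α))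

module _ {o ℓ e : Level} (K : TwoCategory o ℓ e) where
  open TwoCategory K

  _▹_ : {A B C : Obj} (g : B ⇒₁ C) {f f' : A ⇒₁ B} → f ⇒₂ f' → (g ∘₁ f) ⇒₂ (g ∘₁ f')
  g ▹ α = id₂ {f = g} ∘ₕ α

  _◃_ : {A B C : Obj} {g g' : B ⇒₁ C} → g ⇒₂ g' → (f : A ⇒₁ B) → (g ∘₁ f) ⇒₂ (g' ∘₁ f)
  β ◃ f = β ∘ₕ id₂ {f = f}

  Invertible : {A B : Obj} {f g : A ⇒₁ B} → f ⇒₂ g → Set e
  Invertible {f = f} {g} α = Σ (g ⇒₂ f) λ β → (β ∘ᵥ α ≡ id₂) × (α ∘ᵥ β ≡ id₂)

  CorepSurj : {A B : Obj} → A ⇒₁ B → Set (o ⊔ ℓ ⊔ e)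
  CorepSurj {A} {B} f = {X : Obj} {g h : B ⇒₁ X} (α : g ⇒₂ h)
                      → Invertible (α ◃ f) → Invertible α

  IsRan : {A B X : Obj} (f : A ⇒₁ B) (x : A ⇒₁ X) (r : B ⇒₁ X) → (r ∘₁ f) ⇒₂ x → Set (ℓ ⊔ e)
  IsRan {B = B} {X} f x r ε =
    (h : B ⇒₁ X) (α : (h ∘₁ f) ⇒₂ x) →
      Σ (h ⇒₂ r) λ β → (ε ∘ᵥ (β ◃ f) ≡ α)
        × ((β' : h ⇒₂ r) → ε ∘ᵥ (β' ◃ f) ≡ α → β' ≡ β)

  IsLan : {A B X : Obj} (f : A ⇒₁ B) (x : A ⇒₁ X) (l : B ⇒₁ X) → x ⇒₂ (l ∘₁ f) → Set (ℓ ⊔ e)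
  IsLan {B = B} {X} f x l η =
    (h : B ⇒₁ X) (α : x ⇒₂ (h ∘₁ f)) →
      Σ (l ⇒₂ h) λ β → ((β ◃ f) ∘ᵥ η ≡ α)
        × ((β' : l ⇒₂ h) → (β' ◃ f) ∘ᵥ η ≡ α → β' ≡ β)

  RightKanInjective : {A B : Obj} → A ⇒₁ B → Obj → Set (ℓ ⊔ e)
  RightKanInjective {A} {B} f X =
    (x : A ⇒₁ X) → Σ (B ⇒₁ X) λ r → Σ ((r ∘₁ f) ⇒₂ x) λ ε → IsRan f x r ε × Invertible ε

  LeftKanInjective : {A B : Obj} → A ⇒₁ B → Obj → Set (ℓ ⊔ e)
  LeftKanInjective {A} {B} f X =
    (x : A ⇒₁ X) → Σ (B ⇒₁ X) λ l → Σ (x ⇒₂ (l ∘₁ f)) λ η → IsLan f x l η × Invertible η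

  PreservesRan : {A B X Y : Obj} (g : X ⇒₁ Y) (f : A ⇒₁ B) (x : A ⇒₁ X) (r : B ⇒₁ X)
               → (r ∘₁ f) ⇒₂ x → Set (ℓ ⊔ e)
  PreservesRan g f x r ε =
    IsRan f (g ∘₁ x) (g ∘₁ r) (subst₂ _⇒₂_ (sym assoc₁) Relation.Binary.PropositionalEquality.refl (g ▹ ε))

  PreservesLan : {A B X Y : Obj} (g : X ⇒₁ Y) (f : A ⇒₁ B) (x : A ⇒₁ X) (l : B ⇒₁ X)
               → x ⇒₂ (l ∘₁ f) → Set (ℓ ⊔ e)
  PreservesLan g f x l η =
    IsLan f (g ∘₁ x) (g ∘₁ l) (subst₂ _⇒₂_ Relation.Binary.PropositionalEquality.refl (sym assoc₁) (g ▹ η))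

  module _ {h : Level} (H : {A B : Obj} → A ⇒₁ B → Set h) where

    RInjObj : Obj → Set (o ⊔ ℓ ⊔ e ⊔ h)
    RInjObj X = {A B : Obj} (f : A ⇒₁ B) → H f → RightKanInjective f X

    LInjObj : Obj → Set (o ⊔ ℓ ⊔ e ⊔ h)
    LInjObj X = {A B : Obj} (f : A ⇒₁ B) → H f → LeftKanInjective f X

    RInj1Cell : {X Y : Obj} → X ⇒₁ Y → Set (o ⊔ ℓ ⊔ e ⊔ h)
    RInj1Cell {X} g = {A B : Obj} (f : A ⇒₁ B) → H f →
      (x : A ⇒₁ X) (r : B ⇒₁ X) (ε : (r ∘₁ f) ⇒₂ x) → IsRan f x r ε → PreservesRan g f x r ε

    LInj1Cell : {X Y : Obj} → X ⇒₁ Y → Set (o ⊔ ℓ ⊔ e ⊔ h)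
    LInj1Cell {X} g = {A B : Obj} (f : A ⇒₁ B) → H f →
      (x : A ⇒₁ X) (l : B ⇒₁ X) (η : x ⇒₂ (l ∘₁ f)) → IsLan f x l η → PreservesLan g f x l η

{-# OPTIONS --safe #-}
-- Along a corepresentably surjective f, once x has a right Kan extension
-- (s , δ) with δ invertible, the right Kan extensions of x are exactly the
-- invertible 2-cells γ : t ∘ f ⇒ x.  Every right Kan extension is isomorphic to
-- (s , δ); conversely the comparison σ : t ⇒ s satisfies σ f = δ⁻¹ γ, so σ f
-- and hence σ are invertible.  Whiskering by g keeps the counit invertible, so
-- g preserves the extension as soon as its codomain is Kan injective.
-- Left Kan extensions are right Kan extensions once 2-cells are reversed.
module Submission where

open import Defs
open import Level using (Level)
open import Data.Product using (_×_; _,_)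
open import Function using (flip)
open import Relation.Binary.PropositionalEquality

subst₂-flip : {a b r : Level} {A : Set a} {B : Set b} (R : A → B → Set r)
              {x y : A} {u v : B} (p : x ≡ y) (q : u ≡ v) (z : R x u)
            → subst₂ (flip R) q p z ≡ subst₂ R p q z
subst₂-flip R refl refl z = refl

module Properties {o ℓ e : Level} (K : TwoCategory o ℓ e) where
  open TwoCategory K
  open ≡-Reasoning

  infixl 11 _◂_
  infixr 11 _▸_

  _◂_ : {A B C : Obj} {g g' : B ⇒₁ C} → g ⇒₂ g' → (f : A ⇒₁ B) → (g ∘₁ f) ⇒₂ (g' ∘₁ f)
  _◂_ = _◃_ K

  _▸_ : {A B C : Obj} (g : B ⇒₁ C) {f f' : A ⇒₁ B} → f ⇒₂ f' → (g ∘₁ f) ⇒₂ (g ∘₁ f')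
  _▸_ = _▹_ K

  ◂-distrib-∘ᵥ : {A B C : Obj} {g g' g'' : B ⇒₁ C} (β : g' ⇒₂ g'') (β' : g ⇒₂ g') (f : A ⇒₁ B)
               → (β ∘ᵥ β') ◂ f ≡ (β ◂ f) ∘ᵥ (β' ◂ f)
  ◂-distrib-∘ᵥ β β' f = trans (cong ((β ∘ᵥ β') ∘ₕ_) (sym identityˡᵥ)) interchange

  ▸-distrib-∘ᵥ : {A B C : Obj} (g : B ⇒₁ C) {f f' f'' : A ⇒₁ B} (α : f' ⇒₂ f'') (α' : f ⇒₂ f')
               → g ▸ (α ∘ᵥ α') ≡ (g ▸ α) ∘ᵥ (g ▸ α')
  ▸-distrib-∘ᵥ g α α' = trans (cong (_∘ₕ (α ∘ᵥ α')) (sym identityˡᵥ)) interchange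

  cancelˡ : {A B : Obj} {f g h : A ⇒₁ B} {a : g ⇒₂ h} {b : h ⇒₂ g} {c : f ⇒₂ g}
          → b ∘ᵥ a ≡ id₂ → b ∘ᵥ (a ∘ᵥ c) ≡ c
  cancelˡ {a = a} {b} {c} b∘a≡id = begin
    b ∘ᵥ (a ∘ᵥ c)  ≡⟨ sym assocᵥ ⟩
    (b ∘ᵥ a) ∘ᵥ c  ≡⟨ cong (_∘ᵥ c) b∘a≡id ⟩
    id₂ ∘ᵥ c       ≡⟨ identityˡᵥ ⟩
    c              ∎

  invertible-inverse : {A B : Obj} {f g : A ⇒₁ B} {α : f ⇒₂ g} ((α⁻¹ , _) : Invertible K α)
                     → Invertible K α⁻¹
  invertible-inverse {α = α} (_ , α⁻¹∘α≡id , α∘α⁻¹≡id) = α , α∘α⁻¹≡id , α⁻¹∘α≡id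

  invertible-∘ᵥ : {A B : Obj} {f g h : A ⇒₁ B} {α : f ⇒₂ g} {β : g ⇒₂ h}
                → Invertible K β → Invertible K α → Invertible K (β ∘ᵥ α)
  invertible-∘ᵥ {β = β} (β⁻¹ , β⁻¹∘β≡id , β∘β⁻¹≡id) (α⁻¹ , α⁻¹∘α≡id , α∘α⁻¹≡id) =
      α⁻¹ ∘ᵥ β⁻¹
    , trans assocᵥ (trans (cong (α⁻¹ ∘ᵥ_) (cancelˡ β⁻¹∘β≡id)) α⁻¹∘α≡id)
    , trans assocᵥ (trans (cong (β ∘ᵥ_) (cancelˡ α∘α⁻¹≡id)) β∘β⁻¹≡id)

  invertible-cancelˡ : {A B : Obj} {f g h : A ⇒₁ B} {α : f ⇒₂ g} {β : g ⇒₂ h}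
                     → Invertible K β → Invertible K (β ∘ᵥ α) → Invertible K α
  invertible-cancelˡ β-inv@(_ , β⁻¹∘β≡id , _) βα-inv =
    subst (Invertible K) (cancelˡ β⁻¹∘β≡id) (invertible-∘ᵥ (invertible-inverse β-inv) βα-inv)

  invertible-◂ : {A B C : Obj} {g g' : B ⇒₁ C} {β : g ⇒₂ g'} (f : A ⇒₁ B)
               → Invertible K β → Invertible K (β ◂ f)
  invertible-◂ {β = β} f (β⁻¹ , β⁻¹∘β≡id , β∘β⁻¹≡id) =
      β⁻¹ ◂ f
    , trans (sym (◂-distrib-∘ᵥ β⁻¹ β f)) (trans (cong (_◂ f) β⁻¹∘β≡id) ∘ₕ-id)
    , trans (sym (◂-distrib-∘ᵥ β β⁻¹ f)) (trans (cong (_◂ f) β∘β⁻¹≡id) ∘ₕ-id)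

  invertible-▸ : {A B C : Obj} (g : B ⇒₁ C) {f f' : A ⇒₁ B} {α : f ⇒₂ f'}
               → Invertible K α → Invertible K (g ▸ α)
  invertible-▸ g {α = α} (α⁻¹ , α⁻¹∘α≡id , α∘α⁻¹≡id) =
      g ▸ α⁻¹
    , trans (sym (▸-distrib-∘ᵥ g α⁻¹ α)) (trans (cong (g ▸_) α⁻¹∘α≡id) ∘ₕ-id)
    , trans (sym (▸-distrib-∘ᵥ g α α⁻¹)) (trans (cong (g ▸_) α∘α⁻¹≡id) ∘ₕ-id)

  invertible-subst₂ : {A B : Obj} {a b c d : A ⇒₁ B} (p : a ≡ b) (q : c ≡ d) {α : a ⇒₂ c}
                    → Invertible K α → Invertible K (subst₂ _⇒₂_ p q α)
  invertible-subst₂ refl refl α-inv = α-inv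

  factor-∘ᵥ : {A B X : Obj} {f : A ⇒₁ B} {x : A ⇒₁ X} {r r' r'' : B ⇒₁ X}
              {ε : (r ∘₁ f) ⇒₂ x} {ε' : (r' ∘₁ f) ⇒₂ x} {ε'' : (r'' ∘₁ f) ⇒₂ x}
              {β : r' ⇒₂ r} {β' : r'' ⇒₂ r'}
            → ε ∘ᵥ (β ◂ f) ≡ ε' → ε' ∘ᵥ (β' ◂ f) ≡ ε'' → ε ∘ᵥ ((β ∘ᵥ β') ◂ f) ≡ ε''
  factor-∘ᵥ {f = f} {ε = ε} {ε'} {ε''} {β} {β'} ε∘β≡ε' ε'∘β'≡ε'' = begin
    ε ∘ᵥ ((β ∘ᵥ β') ◂ f)         ≡⟨ cong (ε ∘ᵥ_) (◂-distrib-∘ᵥ β β' f) ⟩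
    ε ∘ᵥ ((β ◂ f) ∘ᵥ (β' ◂ f))   ≡⟨ sym assocᵥ ⟩
    (ε ∘ᵥ (β ◂ f)) ∘ᵥ (β' ◂ f)   ≡⟨ cong (_∘ᵥ (β' ◂ f)) ε∘β≡ε' ⟩
    ε' ∘ᵥ (β' ◂ f)               ≡⟨ ε'∘β'≡ε'' ⟩
    ε''                          ∎

  module _ {A B X : Obj} {f : A ⇒₁ B} {x : A ⇒₁ X} where

    ran-endomorphism≡id : {r : B ⇒₁ X} {ε : (r ∘₁ f) ⇒₂ x} → IsRan K f x r ε
                        → (φ : r ⇒₂ r) → ε ∘ᵥ (φ ◂ f) ≡ ε → φ ≡ id₂
    ran-endomorphism≡id {r} {ε} ran φ ε∘φ≡ε =
      let (_ , _ , unique) = ran r ε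
      in trans (unique φ ε∘φ≡ε) (sym (unique id₂ (trans (cong (ε ∘ᵥ_) ∘ₕ-id) identityʳᵥ)))

    ran-comparison-invertible : {r r' : B ⇒₁ X} {ε : (r ∘₁ f) ⇒₂ x} {ε' : (r' ∘₁ f) ⇒₂ x}
                              → IsRan K f x r ε → IsRan K f x r' ε'
                              → (β : r ⇒₂ r') → ε' ∘ᵥ (β ◂ f) ≡ ε → Invertible K β
    ran-comparison-invertible {r' = r'} {ε' = ε'} ran ran' β ε'∘β≡ε =
      let (β⁻¹ , ε∘β⁻¹≡ε' , _) = ran r' ε'
      in  β⁻¹
        , ran-endomorphism≡id ran (β⁻¹ ∘ᵥ β) (factor-∘ᵥ ε∘β⁻¹≡ε' ε'∘β≡ε)
        , ran-endomorphism≡id ran' (β ∘ᵥ β⁻¹) (factor-∘ᵥ ε'∘β≡ε ε∘β⁻¹≡ε')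

    ran-counit-invertible : {r r' : B ⇒₁ X} {ε : (r ∘₁ f) ⇒₂ x} {ε' : (r' ∘₁ f) ⇒₂ x}
                          → IsRan K f x r ε → IsRan K f x r' ε'
                          → Invertible K ε' → Invertible K ε
    ran-counit-invertible {r} {ε = ε} ran ran' ε'-inv =
      let (β , ε'∘β≡ε , _) = ran' r ε
      in  subst (Invertible K) ε'∘β≡ε
            (invertible-∘ᵥ ε'-inv (invertible-◂ f (ran-comparison-invertible ran ran' β ε'∘β≡ε)))

    ran-precompose-invertible : {s t : B ⇒₁ X} {δ : (s ∘₁ f) ⇒₂ x} → IsRan K f x s δ
                              → (σ : t ⇒₂ s) → Invertible K σ
                              → (γ : (t ∘₁ f) ⇒₂ x) → δ ∘ᵥ (σ ◂ f) ≡ γ → IsRan K f x t γ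
    ran-precompose-invertible {δ = δ} ran σ (σ⁻¹ , σ⁻¹∘σ≡id , σ∘σ⁻¹≡id) γ δ∘σ≡γ h α =
      let (β , δ∘β≡α , unique) = ran h α
      in  σ⁻¹ ∘ᵥ β
        , (begin
            γ ∘ᵥ ((σ⁻¹ ∘ᵥ β) ◂ f)           ≡⟨ sym (factor-∘ᵥ δ∘σ≡γ refl) ⟩
            δ ∘ᵥ ((σ ∘ᵥ (σ⁻¹ ∘ᵥ β)) ◂ f)    ≡⟨ cong (λ τ → δ ∘ᵥ (τ ◂ f)) (cancelˡ σ∘σ⁻¹≡id) ⟩
            δ ∘ᵥ (β ◂ f)                    ≡⟨ δ∘β≡α ⟩
            α                               ∎)
        , λ β' γ∘β'≡α → begin
            β'                 ≡⟨ sym (cancelˡ σ⁻¹∘σ≡id) ⟩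
            σ⁻¹ ∘ᵥ (σ ∘ᵥ β')   ≡⟨ cong (σ⁻¹ ∘ᵥ_) (unique (σ ∘ᵥ β') (factor-∘ᵥ δ∘σ≡γ γ∘β'≡α)) ⟩
            σ⁻¹ ∘ᵥ β           ∎

    invertible-isRan : {s t : B ⇒₁ X} {δ : (s ∘₁ f) ⇒₂ x} → CorepSurj K f
                     → IsRan K f x s δ → Invertible K δ
                     → (γ : (t ∘₁ f) ⇒₂ x) → Invertible K γ → IsRan K f x t γ
    invertible-isRan {t = t} f-surj ran δ-inv γ γ-inv =
      let (σ , δ∘σ≡γ , _) = ran t γ
          σ-inv = f-surj σ (invertible-cancelˡ δ-inv (subst (Invertible K) (sym δ∘σ≡γ) γ-inv))
      in  ran-precompose-invertible ran σ σ-inv γ δ∘σ≡γ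

  kanInjective-preservesRan : {A B X Y : Obj} {f : A ⇒₁ B} → CorepSurj K f
                            → RightKanInjective K f X → RightKanInjective K f Y
                            → (g : X ⇒₁ Y) (x : A ⇒₁ X) (r : B ⇒₁ X) (ε : (r ∘₁ f) ⇒₂ x)
                            → IsRan K f x r ε → PreservesRan K g f x r ε
  kanInjective-preservesRan f-surj X-inj Y-inj g x r ε ran =
    let (_ , _ , ranX , ε'-inv) = X-inj x
        (_ , _ , ranY , δ-inv) = Y-inj (g ∘₁ x)
    in  invertible-isRan f-surj ranY δ-inv _
          (invertible-subst₂ (sym assoc₁) refl
            (invertible-▸ g (ran-counit-invertible ran ranX ε'-inv)))

co : {o ℓ e : Level} → TwoCategory o ℓ e → TwoCategory o ℓ e
co K = record
  { Obj         = Obj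
  ; _⇒₁_        = _⇒₁_
  ; _⇒₂_        = flip _⇒₂_
  ; id₁         = id₁
  ; _∘₁_        = _∘₁_
  ; identityˡ₁  = identityˡ₁
  ; identityʳ₁  = identityʳ₁
  ; assoc₁      = assoc₁
  ; id₂         = id₂
  ; _∘ᵥ_        = flip _∘ᵥ_
  ; identityˡᵥ  = identityʳᵥ
  ; identityʳᵥ  = identityˡᵥ
  ; assocᵥ      = sym assocᵥ
  ; _∘ₕ_        = _∘ₕ_
  ; ∘ₕ-id       = ∘ₕ-id
  ; interchange = interchange
  ; identityˡₕ  = λ {α = α} →
      trans identityˡₕ (sym (subst₂-flip _⇒₂_ (sym identityˡ₁) (sym identityˡ₁) α))
  ; identityʳₕ  = λ {α = α} →
      trans identityʳₕ (sym (subst₂-flip _⇒₂_ (sym identityʳ₁) (sym identityʳ₁) α))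
  ; assocₕ      = λ {α = α} {β} {γ} →
      trans assocₕ (sym (subst₂-flip _⇒₂_ (sym assoc₁) (sym assoc₁) (γ ∘ₕ (β ∘ₕ α))))
  }
  where open TwoCategory K

module _ {o ℓ e : Level} {K : TwoCategory o ℓ e} where
  open TwoCategory K

  invertible-co : {A B : Obj} {f g : A ⇒₁ B} {α : f ⇒₂ g}
                → Invertible K α → Invertible (co K) α
  invertible-co (α⁻¹ , α⁻¹∘α≡id , α∘α⁻¹≡id) = α⁻¹ , α∘α⁻¹≡id , α⁻¹∘α≡id

  invertible-co⁻¹ : {A B : Obj} {f g : A ⇒₁ B} {α : f ⇒₂ g}
                  → Invertible (co K) α → Invertible K α
  invertible-co⁻¹ (α⁻¹ , α∘α⁻¹≡id , α⁻¹∘α≡id) = α⁻¹ , α⁻¹∘α≡id , α∘α⁻¹≡id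

  corepSurj-co : {A B : Obj} {f : A ⇒₁ B} → CorepSurj K f → CorepSurj (co K) f
  corepSurj-co f-surj α αf-inv = invertible-co (f-surj α (invertible-co⁻¹ αf-inv))

  leftKanInjective-co : {A B X : Obj} {f : A ⇒₁ B}
                      → LeftKanInjective K f X → RightKanInjective (co K) f X
  leftKanInjective-co X-inj x = let (l , η , lan , η-inv) = X-inj x
                                in  l , η , lan , invertible-co η-inv

  kanInjective-preservesLan : {A B X Y : Obj} {f : A ⇒₁ B} → CorepSurj K f
                            → LeftKanInjective K f X → LeftKanInjective K f Y
                            → (g : X ⇒₁ Y) (x : A ⇒₁ X) (l : B ⇒₁ X) (η : x ⇒₂ (l ∘₁ f))
                            → IsLan K f x l η → PreservesLan K g f x l η
  -- IsLan K is IsRan (co K) on the nose; the two notions of preservation differ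
  -- only in the orientation of the transport along assoc₁.
  kanInjective-preservesLan f-surj X-inj Y-inj g x l η lan =
    subst (IsLan K _ (g ∘₁ x) (g ∘₁ l)) (subst₂-flip _⇒₂_ refl (sym assoc₁) (_▹_ K g η))
      (Properties.kanInjective-preservesRan (co K) (corepSurj-co f-surj)
        (leftKanInjective-co X-inj) (leftKanInjective-co Y-inj) g x l η lan)

proposition2p3p3 : {o ℓ e h : Level} (K : TwoCategory o ℓ e)
    (H : {A B : TwoCategory.Obj K} → TwoCategory._⇒₁_ K A B → Set h)
    → ({A B : TwoCategory.Obj K} (f : TwoCategory._⇒₁_ K A B) → H f → CorepSurj K f)
    → ({X Y : TwoCategory.Obj K} → RInjObj K H X → RInjObj K H Y
         → (g : TwoCategory._⇒₁_ K X Y) → RInj1Cell K H g)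
      × ({X Y : TwoCategory.Obj K} → LInjObj K H X → LInjObj K H Y
         → (g : TwoCategory._⇒₁_ K X Y) → LInj1Cell K H g)
proposition2p3p3 K H H⊆CorepSurj =
    (λ X-inj Y-inj g f f∈H →
       Properties.kanInjective-preservesRan K (H⊆CorepSurj f f∈H) (X-inj f f∈H) (Y-inj f f∈H) g)
  , (λ X-inj Y-inj g f f∈H →
       kanInjective-preservesLan {K = K} (H⊆CorepSurj f f∈H) (X-inj f f∈H) (Y-inj f f∈H) g)
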